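{- Let $A,B$ be sets, $F=\Delta_B\times\mathrm{Id}^A$ on $\mathbf{Set}$, $R\subseteq A^*\times A^*$, and $(M,*,1_M)$ a monoid presented by $A$ and $R$. Let $\Sigma_R=\{\partial_w\equiv\partial_u\mid(w,u)\in R\}$. Define the Moore automaton $(Z_R,\langle o_R,\delta_R\rangle)$ by $Z_R=B^M$, $o_R(\theta)=\theta(1_M)$ and $\delta_R(\theta)(a)(s)=\theta(a*s)$ for $\theta\in B^M$, $a\in A$, $s\in M$ (identifying $a$ with its image in $M$). Then $(Z_R,\langle o_R,\delta_R\rangle)$ is final relative to $\mathbf{Coalg}(F,\Sigma_R)$: it satisfies $\Sigma_R$, and every Moore automaton satisfying $\Sigma_R$ has exactly one homomorphism into it.
   Context: A Moore automaton is an $F$-coalgebra $(X,\langle o,\delta\rangle)$ with $o\colon X\to B$ and $\delta\colon X\to X^A$; a homomorphism $h$ to $(Y,\langle o',\delta'\rangle)$ satisfies $o'\circ h=o$ and $\delta'(h(x))(a)=h(\delta(x)(a))$. For $a\in A$ the derivative $\partial_a\colon F\Rightarrow\mathrm{Id}$ is $(\partial_a)_X(p,\theta)=\theta(a)$, and for $w=a_1\cdots a_n$, $\partial_w=\partial_{a_n}\cdots\partial_{a_1}\colon F^{n}\Rightarrow\mathrm{Id}$. Concretely, for a Moore automaton, $\partial_w(\beta^n(x))$ is the state reached from $x$ by reading $a_1,\dots,a_n$ in order (i.e. $x_0=x$, $x_{j}=\delta(x_{j-1})(a_j)$, result $x_n$), where $\beta^0=\mathrm{id}$, $\beta^{n+1}=F(\beta^n)\circ\beta$.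 A Moore automaton satisfies $\partial_w\equiv\partial_u$ if $\partial_w\circ\beta^{|w|}=\partial_u\circ\beta^{|u|}$, i.e. reading $w$ and reading $u$ from any state reach the same state; $\mathbf{Coalg}(F,\Sigma_R)$ consists of automata satisfying all of $\Sigma_R$. $(M,*,1_M)$ is presented by $A$ and $R$ if it is isomorphic to $A^*/{\approx_R}$ with concatenation, where $\approx_R$ is the least congruence on the free monoid $A^*$ containing $R$. -}

module Defs where

open import Data.List using (List; []; _∷_; _++_; [_])
open import Data.Product using (Σ; ∃; _×_)
open import Relation.Binary.PropositionalEquality using (_≡_)

data Cong {A : Set} (R : List A → List A → Set) : List A → List A → Set where
  base  : ∀ {w u} → R w u → Cong R w u
  refl  : ∀ {w} → Cong R w w
  sym   : ∀ {w u} → Cong R w u → Cong R u w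
  trans : ∀ {w u v} → Cong R w u → Cong R u v → Cong R w v
  cong  : ∀ {w u w′ u′} → Cong R w u → Cong R w′ u′ → Cong R (w ++ w′) (u ++ u′)

-- (M,*,1_M) is presented by A and R: φ : A* → M is a monoid homomorphism
-- (concatenation to *), surjective, whose kernel is exactly ≈_R; i.e. φ induces
-- a monoid isomorphism A*/≈_R ≅ M.  The letter a ∈ A is identified with φ [ a ].
record IsPresentation {A M : Set} (_*_ : M → M → M) (1M : M)
                      (R : List A → List A → Set) (φ : List A → M) : Set where
  field
    φ-[]     : φ [] ≡ 1M
    φ-++     : ∀ w u → φ (w ++ u) ≡ φ w * φ u
    φ-surj   : ∀ m → ∃ λ w → φ w ≡ m
    φ-sound  : ∀ w u → Cong R w u → φ w ≡ φ u
    φ-inj    : ∀ w u → φ w ≡ φ u → Cong R w u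

-- Moore automata (F = Δ_B × Id^A coalgebras).
record Moore (A B : Set) : Set₁ where
  field
    State : Set
    out   : State → B
    next  : State → A → State

open Moore public

run : {A B : Set} (X : Moore A B) → State X → List A → State X
run X x []      = x
run X x (a ∷ w) = run X (next X x a) w

Satisfies : {A B : Set} (R : List A → List A → Set) (X : Moore A B) → Set
Satisfies R X = ∀ w u → R w u → ∀ x → run X x w ≡ run X x u

ZR : {A B M : Set} (_*_ : M → M → M) (1M : M) (φ : List A → M) → Moore A B
ZR {A} {B} {M} _*_ 1M φ = record
  { State = M → B
  ; out   = λ θ → θ 1M
  ; next  = λ θ a s → θ (φ [ a ] * s)
  }

-- Satisfaction of Σ_R by Z_R; states of Z_R are functions M → B, whose
-- equality is (extensional) pointwise equality.
SatisfiesZ : {A B M : Set} (_*_ : M → M → M) (1M : M) (φ : List A → M)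
             (R : List A → List A → Set) → Set
SatisfiesZ {A} {B} {M} _*_ 1M φ R =
  ∀ w u → R w u → ∀ (θ : M → B) (s : M) →
    run (ZR {A} {B} _*_ 1M φ) θ w s ≡ run (ZR {A} {B} _*_ 1M φ) θ u s

IsHomZ : {A B M : Set} (_*_ : M → M → M) (1M : M) (φ : List A → M)
         (X : Moore A B) (h : State X → M → B) → Set
IsHomZ {A} {B} {M} _*_ 1M φ X h =
  (∀ x → h x 1M ≡ out X x) ×
  (∀ x a (s : M) → h x (φ [ a ] * s) ≡ h (next X x a) s)

-- The behaviour of a state x sends m ∈ M to the output after reading any word
-- w with φ w = m.  This does not depend on the choice of w: words with the same
-- image are ≈_R-related, and an automaton satisfying Σ_R also satisfies every
-- consequence of R under the congruence closure, since reading is compatible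
-- with concatenation.  Any homomorphism into Z_R is forced to be the behaviour
-- on the image of φ, which is all of M.
module Submission where

open import Defs
open import Data.List using (List; []; _∷_; _++_; [_])
open import Data.Product using (Σ; _×_; _,_; proj₁; proj₂)
open import Algebra.Structures using (IsMonoid)
open import Relation.Binary.PropositionalEquality as ≡ using (_≡_; module ≡-Reasoning)

run-++ : {A B : Set} (X : Moore A B) (x : State X) (w u : List A) →
         run X x (w ++ u) ≡ run X (run X x w) u
run-++ X x []      u = ≡.refl
run-++ X x (a ∷ w) u = run-++ X (next X x a) w u

Cong⇒run≡ : {A B : Set} {R : List A → List A → Set} (X : Moore A B) → Satisfies R X →
            ∀ {w u} → Cong R w u → ∀ x → run X x w ≡ run X x u
Cong⇒run≡ X sat (base {w} {u} r) x = sat w u r x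
Cong⇒run≡ X sat refl             x = ≡.refl
Cong⇒run≡ X sat (sym c)          x = ≡.sym (Cong⇒run≡ X sat c x)
Cong⇒run≡ X sat (trans c d)      x = ≡.trans (Cong⇒run≡ X sat c x) (Cong⇒run≡ X sat d x)
Cong⇒run≡ X sat (cong {w} {u} {w′} {u′} c d) x = begin
  run X x (w ++ w′)       ≡⟨ run-++ X x w w′ ⟩
  run X (run X x w) w′    ≡⟨ ≡.cong (λ y → run X y w′) (Cong⇒run≡ X sat c x) ⟩
  run X (run X x u) w′    ≡⟨ Cong⇒run≡ X sat d (run X x u) ⟩
  run X (run X x u) u′    ≡⟨ ≡.sym (run-++ X x u u′) ⟩
  run X x (u ++ u′)       ∎
  where open ≡-Reasoning

module _ {A B M : Set} {_*_ : M → M → M} {1M : M} (isMonoid : IsMonoid _≡_ _*_ 1M)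
         {R : List A → List A → Set} {φ : List A → M} (pres : IsPresentation _*_ 1M R φ)
         where

  open IsMonoid isMonoid using (assoc; identityˡ)
  open IsPresentation pres

  private
    Z : Moore A B
    Z = ZR _*_ 1M φ

  run-ZR : ∀ w (θ : M → B) s → run Z θ w s ≡ θ (φ w * s)
  run-ZR [] θ s = ≡.cong θ (begin
    s           ≡⟨ ≡.sym (identityˡ s) ⟩
    1M * s      ≡⟨ ≡.cong (_* s) (≡.sym φ-[]) ⟩
    φ [] * s    ∎)
    where open ≡-Reasoning
  run-ZR (a ∷ w) θ s = ≡.trans (run-ZR w (λ t → θ (φ [ a ] * t)) s) (≡.cong θ (begin
    φ [ a ] * (φ w * s)    ≡⟨ ≡.sym (assoc (φ [ a ]) (φ w) s) ⟩
    (φ [ a ] * φ w) * s    ≡⟨ ≡.cong (_* s) (≡.sym (φ-++ [ a ] w)) ⟩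
    φ (a ∷ w) * s          ∎))
    where open ≡-Reasoning

  ZR-satisfies : SatisfiesZ {B = B} _*_ 1M φ R
  ZR-satisfies w u r θ s = begin
    run Z θ w s    ≡⟨ run-ZR w θ s ⟩
    θ (φ w * s)    ≡⟨ ≡.cong (λ m → θ (m * s)) (φ-sound w u (base r)) ⟩
    θ (φ u * s)    ≡⟨ ≡.sym (run-ZR u θ s) ⟩
    run Z θ u s    ∎
    where open ≡-Reasoning

  IsHomZ⇒on-words : (X : Moore A B) (h : State X → M → B) → IsHomZ _*_ 1M φ X h →
                    ∀ w x → h x (φ w) ≡ out X (run X x w)
  IsHomZ⇒on-words X h (h-out , _) [] x = ≡.trans (≡.cong (h x) φ-[]) (h-out x)
  IsHomZ⇒on-words X h hom@(_ , h-next) (a ∷ w) x = begin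
    h x (φ (a ∷ w))              ≡⟨ ≡.cong (h x) (φ-++ [ a ] w) ⟩
    h x (φ [ a ] * φ w)          ≡⟨ h-next x a (φ w) ⟩
    h (next X x a) (φ w)         ≡⟨ IsHomZ⇒on-words X h hom w (next X x a) ⟩
    out X (run X x (a ∷ w))      ∎
    where open ≡-Reasoning

  module _ (X : Moore A B) (sat : Satisfies R X) where

    representative : M → List A
    representative m = proj₁ (φ-surj m)

    φ-representative : ∀ m → φ (representative m) ≡ m
    φ-representative m = proj₂ (φ-surj m)

    φ≡⇒run≡ : ∀ {w u} → φ w ≡ φ u → ∀ x → run X x w ≡ run X x u
    φ≡⇒run≡ {w} {u} e = Cong⇒run≡ X sat (φ-inj w u e)

    behaviour : State X → M → B
    behaviour x m = out X (run X x (representative m))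

    behaviour-isHomZ : IsHomZ _*_ 1M φ X behaviour
    behaviour-isHomZ = behaviour-out , behaviour-next
      where
      behaviour-out : ∀ x → behaviour x 1M ≡ out X x
      behaviour-out x =
        ≡.cong (out X) (φ≡⇒run≡ (≡.trans (φ-representative 1M) (≡.sym φ-[])) x)

      φ-step : ∀ a s → φ (representative (φ [ a ] * s)) ≡ φ (a ∷ representative s)
      φ-step a s = begin
        φ (representative (φ [ a ] * s))    ≡⟨ φ-representative (φ [ a ] * s) ⟩
        φ [ a ] * s                         ≡⟨ ≡.cong (φ [ a ] *_) (≡.sym (φ-representative s)) ⟩
        φ [ a ] * φ (representative s)      ≡⟨ ≡.sym (φ-++ [ a ] (representative s)) ⟩
        φ (a ∷ representative s)            ∎
        where open ≡-Reasoning

      behaviour-next : ∀ x a s → behaviour x (φ [ a ] * s) ≡ behaviour (next X x a) s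
      behaviour-next x a s = ≡.cong (out X) (φ≡⇒run≡ (φ-step a s) x)

    IsHomZ⇒≡behaviour : (h : State X → M → B) → IsHomZ _*_ 1M φ X h →
                        ∀ x s → h x s ≡ behaviour x s
    IsHomZ⇒≡behaviour h hom x s =
      ≡.trans (≡.cong (h x) (≡.sym (φ-representative s)))
              (IsHomZ⇒on-words X h hom (representative s) x)

proposition1 : {A B M : Set} (_*_ : M → M → M) (1M : M) → IsMonoid _≡_ _*_ 1M →
               (R : List A → List A → Set) (φ : List A → M) →
               IsPresentation _*_ 1M R φ →
               SatisfiesZ {A} {B} _*_ 1M φ R ×
               ((X : Moore A B) → Satisfies R X →
                 Σ (State X → M → B) (λ h →
                   IsHomZ _*_ 1M φ X h ×
                   ((h′ : State X → M → B) → IsHomZ _*_ 1M φ X h′ →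
                     ∀ x s → h′ x s ≡ h x s)))
proposition1 _*_ 1M isMonoid R φ pres =
  ZR-satisfies isMonoid pres ,
  λ X sat → behaviour isMonoid pres X sat ,
            behaviour-isHomZ isMonoid pres X sat ,
            IsHomZ⇒≡behaviour isMonoid pres X sat
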